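{- For all nonnegative integers $m,n$, \[ \sum_{N=0}^{m+n}a^Nq^{N^2}\sum_{k=0}^{N}b^kq^{k^2}{m\brack k}_{q^2}{n\brack N-k}_{q^2}=\sum_{i=0}^{m}(ab)^iq^{2i^2}{m\brack i}_{q^2}(-aq^{2i+1};q^2)_n . \]
   Context: $a,b,q$ are indeterminates. For $n\ge 0$, $(x;p)_n=\prod_{j=0}^{n-1}(1-xp^j)$. For integers $n\ge 0$ and $m$, ${n\brack m}_{p}=\frac{(p;p)_n}{(p;p)_m(p;p)_{n-m}}$ if $0\le m\le n$ and ${n\brack m}_p=0$ otherwise; here it is used with $p=q^2$. -}

module Defs where

open import Level using (Level)
open import Data.Nat using (ℕ; zero; suc; _∸_)
open import Algebra.Bundles using (CommutativeRing)

module _ {c ℓ : Level} (R : CommutativeRing c ℓ) where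
  open CommutativeRing R using (Carrier; _+_; _*_; -_; 0#; 1#)

  pow : Carrier → ℕ → Carrier
  pow x zero    = 1#
  pow x (suc n) = pow x n * x

  sumTo : ℕ → (ℕ → Carrier) → Carrier
  sumTo zero    f = f zero
  sumTo (suc n) f = sumTo n f + f (suc n)

  poch : Carrier → Carrier → ℕ → Carrier
  poch x p zero    = 1#
  poch x p (suc n) = poch x p n * (1# + - (x * pow p n))

  -- Gaussian binomial coefficient [n over m]_p as a polynomial in p
  -- (q-Pascal recursion; equals (p;p)_n / ((p;p)_m (p;p)_{n-m}) for 0 ≤ m ≤ n, 0 for m > n)
  qbinom : Carrier → ℕ → ℕ → Carrier
  qbinom p zero    zero    = 1#
  qbinom p zero    (suc m) = 0#
  qbinom p (suc n) zero    = 1#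
  qbinom p (suc n) (suc m) = qbinom p n m + pow p (suc m) * qbinom p n (suc m)

{-# OPTIONS --safe #-}
-- Multiplying out, the left side is a sum of a^(i+j) b^i q^((i+j)²+i²) [m,i] [n,j] over the
-- triangle N = i + j ≤ m + n; as the Gaussian binomials vanish outside i ≤ m, j ≤ n it is a sum
-- over a rectangle. Since (i+j)² + i² = 2i² + 2ij + j², the term splits as
-- (ab)^i q^(2i²) [m,i] · (a q^(2i))^j q^(j²) [n,j], and for each i the sum over j is Cauchy's
-- q-binomial theorem (-c q; q²)_n = Σ_j c^j q^(j²) [n,j] with c = a q^(2i). Cauchy's theorem
-- follows by induction on n: peeling off the first factor 1 + c q of the Pochhammer symbol
-- turns c into c q², and the q-Pascal rule recombines the two resulting sums.
module Submission where

open import Level using (Level)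
open import Algebra.Bundles using (CommutativeRing)
open import Data.Nat using (ℕ; zero; suc; _∸_; _≤_; _<_; z≤n; s≤s) renaming (_+_ to _+ℕ_; _*_ to _*ℕ_)
import Data.Nat.Properties as ℕ
open import Data.Nat.Tactic.RingSolver using (solve-∀)
open import Data.Sum using (inj₁; inj₂)
open import Relation.Binary.PropositionalEquality as ≡ using (_≡_; cong)

open import Defs

suc-square : ∀ j → suc j *ℕ suc j ≡ suc (j *ℕ j +ℕ (j +ℕ j))
suc-square = solve-∀

sum-square+square : ∀ i j →
  (i +ℕ j) *ℕ (i +ℕ j) +ℕ i *ℕ i ≡ 2 *ℕ (i *ℕ i) +ℕ 2 *ℕ i *ℕ j +ℕ j *ℕ j
sum-square+square = solve-∀

module Properties {c ℓ : Level} (R : CommutativeRing c ℓ) where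
  open CommutativeRing R hiding (zero)
  open import Relation.Binary.Reasoning.Setoid setoid
  open import Algebra.Properties.Semiring.Exp semiring using (_^_; ^-congˡ; ^-homo-*; ^-assocʳ)
  open import Algebra.Properties.CommutativeSemiring.Exp commutativeSemiring using (^-distrib-*)
  open import Algebra.Properties.CommutativeSemigroup +-commutativeSemigroup using (interchange; x∙yz≈xz∙y)
  open import Algebra.Properties.Group +-group using (⁻¹-involutive)
  open import Algebra.Properties.Ring ring using (-‿distribˡ-*)
  open import Algebra.Solver.Ring.NaturalCoefficients.Default commutativeSemiring

  pow≈^ : ∀ x n → pow R x n ≈ x ^ n
  pow≈^ x zero    = refl
  pow≈^ x (suc n) = trans (*-congʳ (pow≈^ x n)) (*-comm _ x)

  pow-cong : ∀ x {m n} → m ≡ n → pow R x m ≈ pow R x n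
  pow-cong x m≡n = reflexive (cong (pow R x) m≡n)

  pow-+ : ∀ x m n → pow R x (m +ℕ n) ≈ pow R x m * pow R x n
  pow-+ x m n = begin
    pow R x (m +ℕ n)        ≈⟨ pow≈^ x (m +ℕ n) ⟩
    x ^ (m +ℕ n)            ≈⟨ ^-homo-* x m n ⟩
    x ^ m * x ^ n           ≈⟨ *-cong (pow≈^ x m) (pow≈^ x n) ⟨
    pow R x m * pow R x n   ∎

  pow-* : ∀ x y n → pow R (x * y) n ≈ pow R x n * pow R y n
  pow-* x y n = begin
    pow R (x * y) n         ≈⟨ pow≈^ (x * y) n ⟩
    (x * y) ^ n             ≈⟨ ^-distrib-* x y n ⟩
    x ^ n * y ^ n           ≈⟨ *-cong (pow≈^ x n) (pow≈^ y n) ⟨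
    pow R x n * pow R y n   ∎

  pow-pow : ∀ x m n → pow R (pow R x m) n ≈ pow R x (m *ℕ n)
  pow-pow x m n = begin
    pow R (pow R x m) n     ≈⟨ pow≈^ (pow R x m) n ⟩
    pow R x m ^ n           ≈⟨ ^-congˡ n (pow≈^ x m) ⟩
    (x ^ m) ^ n             ≈⟨ ^-assocʳ x m n ⟩
    x ^ (m *ℕ n)            ≈⟨ pow≈^ x (m *ℕ n) ⟨
    pow R x (m *ℕ n)        ∎

  pow-suc-square : ∀ q j → pow R q (suc j *ℕ suc j) ≈ pow R q (j *ℕ j) * pow R (q * q) j * q
  pow-suc-square q j = begin
    pow R q (suc j *ℕ suc j)                  ≈⟨ pow-cong q (suc-square j) ⟩
    pow R q (j *ℕ j +ℕ (j +ℕ j)) * q          ≈⟨ *-congʳ (pow-+ q (j *ℕ j) (j +ℕ j)) ⟩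
    pow R q (j *ℕ j) * pow R q (j +ℕ j) * q   ≈⟨ *-congʳ (*-congˡ (trans (pow-+ q j j) (sym (pow-* q q j)))) ⟩
    pow R q (j *ℕ j) * pow R (q * q) j * q    ∎

  pow-sum-square : ∀ q i j →
    pow R q ((i +ℕ j) *ℕ (i +ℕ j)) * pow R q (i *ℕ i)
    ≈ pow R q (2 *ℕ (i *ℕ i)) * pow R (pow R q (2 *ℕ i)) j * pow R q (j *ℕ j)
  pow-sum-square q i j = begin
    pow R q ((i +ℕ j) *ℕ (i +ℕ j)) * pow R q (i *ℕ i)
      ≈⟨ pow-+ q ((i +ℕ j) *ℕ (i +ℕ j)) (i *ℕ i) ⟨
    pow R q ((i +ℕ j) *ℕ (i +ℕ j) +ℕ i *ℕ i)
      ≈⟨ pow-cong q (sum-square+square i j) ⟩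
    pow R q (2 *ℕ (i *ℕ i) +ℕ 2 *ℕ i *ℕ j +ℕ j *ℕ j)
      ≈⟨ pow-+ q (2 *ℕ (i *ℕ i) +ℕ 2 *ℕ i *ℕ j) (j *ℕ j) ⟩
    pow R q (2 *ℕ (i *ℕ i) +ℕ 2 *ℕ i *ℕ j) * pow R q (j *ℕ j)
      ≈⟨ *-congʳ (pow-+ q (2 *ℕ (i *ℕ i)) (2 *ℕ i *ℕ j)) ⟩
    pow R q (2 *ℕ (i *ℕ i)) * pow R q (2 *ℕ i *ℕ j) * pow R q (j *ℕ j)
      ≈⟨ *-congʳ (*-congˡ (pow-pow q (2 *ℕ i) j)) ⟨
    pow R q (2 *ℕ (i *ℕ i)) * pow R (pow R q (2 *ℕ i)) j * pow R q (j *ℕ j)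
      ∎

  sumTo-cong : ∀ n {f g : ℕ → Carrier} → (∀ i → i ≤ n → f i ≈ g i) → sumTo R n f ≈ sumTo R n g
  sumTo-cong zero    f≈g = f≈g 0 z≤n
  sumTo-cong (suc n) f≈g =
    +-cong (sumTo-cong n (λ i i≤n → f≈g i (ℕ.m≤n⇒m≤1+n i≤n))) (f≈g (suc n) ℕ.≤-refl)

  sumTo-+ : ∀ n f g → sumTo R n (λ i → f i + g i) ≈ sumTo R n f + sumTo R n g
  sumTo-+ zero    f g = refl
  sumTo-+ (suc n) f g = trans (+-congʳ (sumTo-+ n f g)) (interchange _ _ _ _)

  sumTo-*ˡ : ∀ n x f → x * sumTo R n f ≈ sumTo R n (λ i → x * f i)
  sumTo-*ˡ zero    x f = refl
  sumTo-*ˡ (suc n) x f = trans (distribˡ x _ _) (+-congʳ (sumTo-*ˡ n x f))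

  sumTo-0 : ∀ n f → (∀ i → f i ≈ 0#) → sumTo R n f ≈ 0#
  sumTo-0 zero    f f≈0 = f≈0 0
  sumTo-0 (suc n) f f≈0 = trans (+-cong (sumTo-0 n f f≈0) (f≈0 (suc n))) (+-identityˡ 0#)

  sumTo-truncate : ∀ {n k} f → n ≤ k → (∀ i → n < i → f i ≈ 0#) → sumTo R k f ≈ sumTo R n f
  sumTo-truncate {k = zero}  f z≤n f≈0 = refl
  sumTo-truncate {k = suc k} f n≤k f≈0 with ℕ.m≤n⇒m<n∨m≡n n≤k
  ... | inj₁ n<k    = trans (+-cong (sumTo-truncate f (ℕ.≤-pred n<k) f≈0) (f≈0 (suc k) n<k)) (+-identityʳ _)
  ... | inj₂ ≡.refl = refl

  sumTo-unfoldˡ : ∀ n f → sumTo R (suc n) f ≈ f 0 + sumTo R n (λ i → f (suc i))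
  sumTo-unfoldˡ zero    f = refl
  sumTo-unfoldˡ (suc n) f = trans (+-congʳ (sumTo-unfoldˡ n f)) (+-assoc _ _ _)

  sumTo-pascal : ∀ n (u v w : ℕ → Carrier) → v 0 ≈ u 0 → (∀ j → v (suc j) ≈ w j + u (suc j)) →
                 sumTo R (suc n) v ≈ sumTo R (suc n) u + sumTo R n w
  sumTo-pascal n u v w v₀≈u₀ v≈w+u = begin
    sumTo R (suc n) v                                   ≈⟨ sumTo-unfoldˡ n v ⟩
    v 0 + sumTo R n (λ j → v (suc j))                   ≈⟨ +-cong v₀≈u₀ (sumTo-cong n (λ j _ → v≈w+u j)) ⟩
    u 0 + sumTo R n (λ j → w j + u (suc j))             ≈⟨ +-congˡ (sumTo-+ n w (λ j → u (suc j))) ⟩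
    u 0 + (sumTo R n w + sumTo R n (λ j → u (suc j)))   ≈⟨ x∙yz≈xz∙y _ _ _ ⟩
    u 0 + sumTo R n (λ j → u (suc j)) + sumTo R n w     ≈⟨ +-congʳ (sumTo-unfoldˡ n u) ⟨
    sumTo R (suc n) u + sumTo R n w                     ∎

  sumTo-triangle-swap : ∀ M (F : ℕ → ℕ → Carrier) →
    sumTo R M (λ N → sumTo R N (F N)) ≈ sumTo R M (λ k → sumTo R (M ∸ k) (λ j → F (k +ℕ j) k))
  sumTo-triangle-swap zero    F = refl
  sumTo-triangle-swap (suc M) F = begin
    sumTo R M (λ N → sumTo R N (F N)) + sumTo R (suc M) (F (suc M))
      ≈⟨ +-congʳ (sumTo-triangle-swap M F) ⟩
    sumTo R M column + (sumTo R M (F (suc M)) + F (suc M) (suc M))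
      ≈⟨ +-assoc _ _ _ ⟨
    sumTo R M column + sumTo R M (F (suc M)) + F (suc M) (suc M)
      ≈⟨ +-cong (sumTo-+ M column (F (suc M))) corner ⟨
    sumTo R M (λ k → column k + F (suc M) k) + column′ (suc M)
      ≈⟨ +-congʳ (sumTo-cong M column-extend) ⟩
    sumTo R M column′ + column′ (suc M)
      ∎
    where
    entry : ℕ → ℕ → Carrier
    entry k j = F (k +ℕ j) k
    column column′ : ℕ → Carrier
    column  k = sumTo R (M ∸ k) (entry k)
    column′ k = sumTo R (suc M ∸ k) (entry k)
    corner : column′ (suc M) ≈ F (suc M) (suc M)
    corner = reflexive (≡.trans (cong (λ t → sumTo R t (entry (suc M))) (ℕ.n∸n≡0 M))
                                (cong (λ t → F t (suc M)) (ℕ.+-identityʳ (suc M))))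
    column-extend : ∀ k → k ≤ M → column k + F (suc M) k ≈ column′ k
    column-extend k k≤M = reflexive (≡.sym (≡.trans (cong (λ t → sumTo R t (entry k)) (ℕ.+-∸-assoc 1 k≤M))
      (cong (λ t → column k + F t k) (≡.trans (ℕ.+-suc k (M ∸ k)) (cong suc (ℕ.m+[n∸m]≡n k≤M))))))

  sumTo-triangle≈rectangle : ∀ m n (F : ℕ → ℕ → Carrier) →
    (∀ i j → m < i → F (i +ℕ j) i ≈ 0#) → (∀ i j → n < j → F (i +ℕ j) i ≈ 0#) →
    sumTo R (m +ℕ n) (λ N → sumTo R N (F N)) ≈ sumTo R m (λ i → sumTo R n (λ j → F (i +ℕ j) i))
  sumTo-triangle≈rectangle m n F F≈0ˡ F≈0ʳ = begin
    sumTo R (m +ℕ n) (λ N → sumTo R N (F N))                 ≈⟨ sumTo-triangle-swap (m +ℕ n) F ⟩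
    sumTo R (m +ℕ n) (λ i → sumTo R (m +ℕ n ∸ i) (entry i))  ≈⟨ sumTo-truncate _ (ℕ.m≤m+n m n) empty-column ⟩
    sumTo R m (λ i → sumTo R (m +ℕ n ∸ i) (entry i))         ≈⟨ sumTo-cong m short-column ⟩
    sumTo R m (λ i → sumTo R n (entry i))                    ∎
    where
    entry : ℕ → ℕ → Carrier
    entry i j = F (i +ℕ j) i
    empty-column : ∀ i → m < i → sumTo R (m +ℕ n ∸ i) (entry i) ≈ 0#
    empty-column i m<i = sumTo-0 (m +ℕ n ∸ i) (entry i) (λ j → F≈0ˡ i j m<i)
    short-column : ∀ i → i ≤ m → sumTo R (m +ℕ n ∸ i) (entry i) ≈ sumTo R n (entry i)
    short-column i i≤m = sumTo-truncate (entry i) n≤m+n∸i (λ j → F≈0ʳ i j)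
      where n≤m+n∸i = ≡.subst (_≤ m +ℕ n ∸ i) (ℕ.m+n∸m≡n m n) (ℕ.∸-monoʳ-≤ (m +ℕ n) i≤m)

  qbinom[n,0]≡1 : ∀ p n → qbinom R p n 0 ≡ 1#
  qbinom[n,0]≡1 p zero    = ≡.refl
  qbinom[n,0]≡1 p (suc n) = ≡.refl

  n<k⇒qbinom[n,k]≈0 : ∀ p {n k} → n < k → qbinom R p n k ≈ 0#
  n<k⇒qbinom[n,k]≈0 p {zero}  {suc k} _         = refl
  n<k⇒qbinom[n,k]≈0 p {suc n} {suc k} (s≤s n<k) = begin
    qbinom R p n k + pow R p (suc k) * qbinom R p n (suc k)
      ≈⟨ +-cong (n<k⇒qbinom[n,k]≈0 p n<k) (*-congˡ (n<k⇒qbinom[n,k]≈0 p (ℕ.m≤n⇒m≤1+n n<k))) ⟩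
    0# + pow R p (suc k) * 0#
      ≈⟨ trans (+-identityˡ _) (zeroʳ _) ⟩
    0#
      ∎

  poch-cong : ∀ {x y} p n → x ≈ y → poch R x p n ≈ poch R y p n
  poch-cong p zero    x≈y = refl
  poch-cong p (suc n) x≈y = *-cong (poch-cong p n x≈y) (+-congˡ (-‿cong (*-congʳ x≈y)))

  poch-unfoldˡ : ∀ x p n → poch R x p (suc n) ≈ (1# + - x) * poch R (x * p) p n
  poch-unfoldˡ x p zero    =
    trans (*-identityˡ _) (trans (+-congˡ (-‿cong (*-identityʳ x))) (sym (*-identityʳ _)))
  poch-unfoldˡ x p (suc n) = begin
    poch R x p (suc n) * (1# + - (x * pow R p (suc n)))
      ≈⟨ *-cong (poch-unfoldˡ x p n) (+-congˡ (-‿cong x[pⁿp]≈[xp]pⁿ)) ⟩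
    (1# + - x) * poch R (x * p) p n * (1# + - (x * p * pow R p n))
      ≈⟨ *-assoc _ _ _ ⟩
    (1# + - x) * (poch R (x * p) p n * (1# + - (x * p * pow R p n)))
      ∎
    where
    x[pⁿp]≈[xp]pⁿ : x * (pow R p n * p) ≈ x * p * pow R p n
    x[pⁿp]≈[xp]pⁿ = solve 3 (λ x p pⁿ → x :* (pⁿ :* p) := x :* p :* pⁿ) refl x p (pow R p n)

  q-binomial-theorem : ∀ q n c →
    poch R (- (c * q)) (q * q) n ≈ sumTo R n (λ j → pow R c j * pow R q (j *ℕ j) * qbinom R (q * q) n j)
  q-binomial-theorem q zero    c = sym (trans (*-identityʳ _) (*-identityʳ _))
  q-binomial-theorem q (suc n) c = begin
    poch R (- (c * q)) p (suc n)                  ≈⟨ poch-unfoldˡ _ p n ⟩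
    (1# + - - (c * q)) * poch R (- (c * q) * p) p n
      ≈⟨ *-cong (+-congˡ (⁻¹-involutive _)) (poch-cong p n -[cq]p≈-[cpq]) ⟩
    (1# + c * q) * poch R (- (c * p * q)) p n     ≈⟨ *-congˡ (q-binomial-theorem q n (c * p)) ⟩
    (1# + c * q) * sumTo R n u                    ≈⟨ distribʳ _ 1# (c * q) ⟩
    1# * sumTo R n u + c * q * sumTo R n u        ≈⟨ +-cong (*-identityˡ _) (sumTo-*ˡ n (c * q) u) ⟩
    sumTo R n u + sumTo R n (λ j → c * q * u j)   ≈⟨ +-cong (sym top-vanishes) (sumTo-cong n (λ j _ → cq*u≈w j)) ⟩
    sumTo R (suc n) u + sumTo R n w               ≈⟨ sumTo-pascal n u v w v₀≈u₀ v≈w+u ⟨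
    sumTo R (suc n) v                             ∎
    where
    p = q * q
    u v w : ℕ → Carrier
    u j = pow R (c * p) j * pow R q (j *ℕ j) * qbinom R p n j
    v j = pow R c j * pow R q (j *ℕ j) * qbinom R p (suc n) j
    w j = pow R c (suc j) * pow R q (suc j *ℕ suc j) * qbinom R p n j

    -[cq]p≈-[cpq] : - (c * q) * p ≈ - (c * p * q)
    -[cq]p≈-[cpq] = trans (sym (-‿distribˡ-* _ _))
      (-‿cong (solve 2 (λ c q → c :* q :* (q :* q) := c :* (q :* q) :* q) refl c q))

    top-vanishes : sumTo R (suc n) u ≈ sumTo R n u
    top-vanishes = trans (+-congˡ (trans (*-congˡ (n<k⇒qbinom[n,k]≈0 p (ℕ.n<1+n n))) (zeroʳ _))) (+-identityʳ _)

    cq*u≈w : ∀ j → c * q * u j ≈ w j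
    cq*u≈w j = begin
      c * q * (pow R (c * p) j * pow R q (j *ℕ j) * qbinom R p n j)
        ≈⟨ *-congˡ (*-congʳ (*-congʳ (pow-* c p j))) ⟩
      c * q * (pow R c j * pow R p j * pow R q (j *ℕ j) * qbinom R p n j)
        ≈⟨ solve 6 (λ c q cʲ pʲ Q b → c :* q :* (cʲ :* pʲ :* Q :* b) := cʲ :* c :* (Q :* pʲ :* q) :* b)
                   refl c q (pow R c j) (pow R p j) (pow R q (j *ℕ j)) (qbinom R p n j) ⟩
      pow R c j * c * (pow R q (j *ℕ j) * pow R p j * q) * qbinom R p n j
        ≈⟨ *-congʳ (*-congˡ (pow-suc-square q j)) ⟨
      w j
        ∎

    v₀≈u₀ : v 0 ≈ u 0
    v₀≈u₀ = *-congˡ (reflexive (≡.sym (qbinom[n,0]≡1 p n)))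

    v≈w+u : ∀ j → v (suc j) ≈ w j + u (suc j)
    v≈w+u j = trans
      (solve 5 (λ cʲ Q b pʲ b′ → cʲ :* Q :* (b :+ pʲ :* b′) := cʲ :* Q :* b :+ cʲ :* pʲ :* Q :* b′)
               refl (pow R c (suc j)) (pow R q (suc j *ℕ suc j)) (qbinom R p n j) (pow R p (suc j)) (qbinom R p n (suc j)))
      (+-congˡ (*-congʳ (*-congʳ (sym (pow-* c p (suc j))))))

  summand-separates : ∀ a b q x y i j →
    pow R a (i +ℕ j) * pow R q ((i +ℕ j) *ℕ (i +ℕ j)) * (pow R b i * pow R q (i *ℕ i) * x * y)
    ≈ pow R (a * b) i * pow R q (2 *ℕ (i *ℕ i)) * x * (pow R (a * pow R q (2 *ℕ i)) j * pow R q (j *ℕ j) * y)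
  summand-separates a b q x y i j = begin
    pow R a (i +ℕ j) * Qᵢ₊ⱼ * (pow R b i * Qᵢ * x * y)
      ≈⟨ *-congʳ (*-congʳ (pow-+ a i j)) ⟩
    pow R a i * pow R a j * Qᵢ₊ⱼ * (pow R b i * Qᵢ * x * y)
      ≈⟨ solve 7 (λ aⁱ aʲ bⁱ x y Q Q′ → aⁱ :* aʲ :* Q :* (bⁱ :* Q′ :* x :* y)
                                        := aⁱ :* bⁱ :* x :* (aʲ :* y) :* (Q :* Q′))
                 refl (pow R a i) (pow R a j) (pow R b i) x y Qᵢ₊ⱼ Qᵢ ⟩
    pow R a i * pow R b i * x * (pow R a j * y) * (Qᵢ₊ⱼ * Qᵢ)
      ≈⟨ *-congˡ (pow-sum-square q i j) ⟩
    pow R a i * pow R b i * x * (pow R a j * y) * (Q₁ * Q₂ * Q₃)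
      ≈⟨ solve 8 (λ aⁱ aʲ bⁱ x y Q₁ Q₂ Q₃ → aⁱ :* bⁱ :* x :* (aʲ :* y) :* (Q₁ :* Q₂ :* Q₃)
                                            := aⁱ :* bⁱ :* Q₁ :* x :* (aʲ :* Q₂ :* Q₃ :* y))
                 refl (pow R a i) (pow R a j) (pow R b i) x y Q₁ Q₂ Q₃ ⟩
    pow R a i * pow R b i * Q₁ * x * (pow R a j * Q₂ * Q₃ * y)
      ≈⟨ *-cong (*-congʳ (*-congʳ (pow-* a b i))) (*-congʳ (*-congʳ (pow-* a (pow R q (2 *ℕ i)) j))) ⟨
    pow R (a * b) i * Q₁ * x * (pow R (a * pow R q (2 *ℕ i)) j * Q₃ * y)
      ∎
    where
    Qᵢ₊ⱼ = pow R q ((i +ℕ j) *ℕ (i +ℕ j))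
    Qᵢ   = pow R q (i *ℕ i)
    Q₁   = pow R q (2 *ℕ (i *ℕ i))
    Q₂   = pow R (pow R q (2 *ℕ i)) j
    Q₃   = pow R q (j *ℕ j)

lemma3p4 : {c ℓ : Level} (R : CommutativeRing c ℓ) (a b q : CommutativeRing.Carrier R) (m n : ℕ) →
    let open CommutativeRing R in
      sumTo R (m +ℕ n) (λ N → pow R a N * pow R q (N *ℕ N) *
        sumTo R N (λ k → pow R b k * pow R q (k *ℕ k) * qbinom R (q * q) m k * qbinom R (q * q) n (N ∸ k)))
      ≈ sumTo R m (λ i → pow R (a * b) i * pow R q (2 *ℕ (i *ℕ i)) * qbinom R (q * q) m i
          * poch R (- (a * pow R q (2 *ℕ i +ℕ 1))) (q * q) n)
lemma3p4 R a b q m n = begin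
  sumTo R (m +ℕ n) (λ N → pow R a N * pow R q (N *ℕ N) * sumTo R N (inner N))
    ≈⟨ sumTo-cong (m +ℕ n) (λ N _ → sumTo-*ˡ N _ (inner N)) ⟩
  sumTo R (m +ℕ n) (λ N → sumTo R N (summand N))
    ≈⟨ sumTo-triangle≈rectangle m n summand summand≈0ˡ summand≈0ʳ ⟩
  sumTo R m (λ i → sumTo R n (λ j → summand (i +ℕ j) i))
    ≈⟨ sumTo-cong m (λ i _ → sumTo-cong n (λ j _ → summand-split i j)) ⟩
  sumTo R m (λ i → sumTo R n (λ j → weight i * cauchy-term i j))
    ≈⟨ sumTo-cong m (λ i _ → sumTo-*ˡ n (weight i) (cauchy-term i)) ⟨
  sumTo R m (λ i → weight i * sumTo R n (cauchy-term i))
    ≈⟨ sumTo-cong m (λ i _ → *-congˡ (cauchy i)) ⟨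
  sumTo R m (λ i → weight i * poch R (- (a * pow R q (2 *ℕ i +ℕ 1))) p n)
    ∎
  where
  open CommutativeRing R
  open Properties R
  open import Relation.Binary.Reasoning.Setoid setoid
  p = q * q
  inner summand cauchy-term : ℕ → ℕ → Carrier
  inner N k = pow R b k * pow R q (k *ℕ k) * qbinom R p m k * qbinom R p n (N ∸ k)
  summand N k = pow R a N * pow R q (N *ℕ N) * inner N k
  cauchy-term i j = pow R (a * pow R q (2 *ℕ i)) j * pow R q (j *ℕ j) * qbinom R p n j
  weight : ℕ → Carrier
  weight i = pow R (a * b) i * pow R q (2 *ℕ (i *ℕ i)) * qbinom R p m i
  summand-split : ∀ i j → summand (i +ℕ j) i ≈ weight i * cauchy-term i j
  summand-split i j = trans (summand-separates a b q _ _ i j)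
                            (*-congˡ (*-congˡ (reflexive (cong (qbinom R p n) (ℕ.m+n∸m≡n i j)))))
  summand≈0ˡ : ∀ i j → m < i → summand (i +ℕ j) i ≈ 0#
  summand≈0ˡ i j m<i = trans (summand-split i j)
    (trans (*-congʳ (trans (*-congˡ (n<k⇒qbinom[n,k]≈0 p m<i)) (zeroʳ _))) (zeroˡ _))
  summand≈0ʳ : ∀ i j → n < j → summand (i +ℕ j) i ≈ 0#
  summand≈0ʳ i j n<j = trans (summand-split i j)
    (trans (*-congˡ (trans (*-congˡ (n<k⇒qbinom[n,k]≈0 p n<j)) (zeroʳ _))) (zeroʳ _))
  cauchy : ∀ i → poch R (- (a * pow R q (2 *ℕ i +ℕ 1))) p n ≈ sumTo R n (cauchy-term i)
  cauchy i = trans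
    (poch-cong p n (-‿cong (trans (*-congˡ (pow-cong q (ℕ.+-comm (2 *ℕ i) 1))) (sym (*-assoc _ _ _)))))
    (q-binomial-theorem q n (a * pow R q (2 *ℕ i)))
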